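{- If $G$ is a homogeneous $m$-generic $L$-graph and $A\in O(G)$, then each bipartite restriction of $A$ is monochromatic: for all distinct $i,j$, all edges of $A$ between its vertices in $V_i$ and its vertices in $V_j$ have the same colour.
   Context: A language $L$ for coloured $m$-partite graphs specifies, for each pair of distinct $i,j\in\{0,\dots,m-1\}$, a finite nonempty set of colours $C_{ij}=C_{ji}$. An $L$-graph has vertex set partitioned into parts $V_0,\dots,V_{m-1}$ (no edges inside parts) with a colour $F(x,y)=F(y,x)\in C_{ij}$ for $x\in V_i,y\in V_j$, $i\ne j$. Substructures are induced subgraphs; embeddings are injective, part- and colour-preserving. $G$ is homogeneous if every isomorphism between finite induced subgraphs extends to an automorphism. $G$ is $m$-generic if every part is countably infinite and for all distinct $i,j$, finite $U\subseteq V_i$ and $f:U\to C_{ij}$ there is $x\in V_j$ with $F(x,u)=f(u)$ for all $u\in U$. A finite $L$-graph is realized in $G$ if it embeds in $G$, otherwise omitted; minimally omitted if omitted but all proper induced subgraphs are realized; $O(G)$ is the class of finite $L$-graphs minimally omitted from $G$. -}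

module Defs where

open import Data.Nat using (ℕ; _≤_; _<_)
open import Data.Fin using (Fin)
open import Data.Fin.Subset using (Subset; _∈_; _∉_)
open import Data.Product using (Σ; ∃; ∃-syntax; _×_; _,_; proj₁)
open import Relation.Binary.PropositionalEquality using (_≡_; _≢_)
open import Relation.Nullary using (¬_)
open import Function.Bundles using (_↔_; Inverse)
open import Function.Definitions using (Injective; Surjective)

-- A language for coloured m-partite graphs: m parts, and for each pair of
-- distinct parts i ≠ j a finite nonempty colour set C i j = {c ∣ c < K i j},
-- with C i j = C j i.
record Lang : Set where
  field
    m     : ℕ
    K     : Fin m → Fin m → ℕ
    K-sym : ∀ i j → K i j ≡ K j i
    K-pos : ∀ i j → i ≢ j → 1 ≤ K i j

open Lang public

-- An L-graph: a vertex type, a part assignment, and a symmetric colouring of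
-- pairs in distinct parts (the value of col on same-part pairs is irrelevant:
-- no edges inside parts, and nothing below ever looks at it).
record LGraph (L : Lang) : Set₁ where
  field
    V     : Set
    part  : V → Fin (m L)
    col   : V → V → ℕ
    col-sym : ∀ x y → part x ≢ part y → col x y ≡ col y x
    col-ok  : ∀ x y → part x ≢ part y → col x y < K L (part x) (part y)

open LGraph public

record Embedding {L : Lang} (A B : LGraph L) : Set where
  field
    map       : V A → V B
    injective : ∀ x y → map x ≡ map y → x ≡ y
    part-pres : ∀ x → part B (map x) ≡ part A x
    col-pres  : ∀ x y → part A x ≢ part A y → col B (map x) (map y) ≡ col A x y

record Automorphism {L : Lang} (G : LGraph L) : Set where
  field
    bij       : V G ↔ V G
    part-pres : ∀ x → part G (Inverse.to bij x) ≡ part G x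
    col-pres  : ∀ x y → part G x ≢ part G y →
                col G (Inverse.to bij x) (Inverse.to bij y) ≡ col G x y

-- A finite induced subgraph of G together with an isomorphism
-- onto another finite induced subgraph is given by two injective
-- enumerations a b : Fin n → V G such that a k ↦ b k preserves parts and
-- colours; it must extend to an automorphism of G.
Homogeneous : {L : Lang} → LGraph L → Set
Homogeneous G =
  ∀ (n : ℕ) (a b : Fin n → V G) →
  (∀ k l → a k ≡ a l → k ≡ l) →
  (∀ k l → b k ≡ b l → k ≡ l) →
  (∀ k → part G (b k) ≡ part G (a k)) →
  (∀ k l → part G (a k) ≢ part G (a l) → col G (b k) (b l) ≡ col G (a k) (a l)) →
  Σ (Automorphism G) λ σ → ∀ k → Inverse.to (Automorphism.bij σ) (a k) ≡ b k

CountablyInfinitePart : {L : Lang} → (G : LGraph L) → Fin (m L) → Set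
CountablyInfinitePart G i =
  Σ (ℕ → V G) λ e →
    (∀ n → part G (e n) ≡ i) ×
    (∀ n n' → e n ≡ e n' → n ≡ n') ×
    (∀ v → part G v ≡ i → ∃[ n ] e n ≡ v)

Generic : {L : Lang} → LGraph L → Set
Generic {L} G =
  (∀ i → CountablyInfinitePart G i) ×
  (∀ (i j : Fin (m L)) → i ≢ j →
   ∀ (n : ℕ) (u : Fin n → V G) →
   (∀ k l → u k ≡ u l → k ≡ l) →          -- U = image of u, a finite subset
   (∀ k → part G (u k) ≡ i) →
   ∀ (f : Fin n → ℕ) → (∀ k → f k < K L i j) →
   ∃[ x ] (part G x ≡ j × ∀ k → col G x (u k) ≡ f k))

-- Induced subgraph of a finite A (vertices enumerated bijectively by
-- ι : Fin n → V A) on the subset S of its vertex set.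
Induced : {L : Lang} {n : ℕ} (A : LGraph L) → (Fin n → V A) → Subset n → LGraph L
Induced A ι S = record
  { V = Σ (Fin _) (λ x → x ∈ S)
  ; part = λ x → part A (ι (proj₁ x))
  ; col = λ x y → col A (ι (proj₁ x)) (ι (proj₁ y))
  ; col-sym = λ x y → col-sym A (ι (proj₁ x)) (ι (proj₁ y))
  ; col-ok = λ x y → col-ok A (ι (proj₁ x)) (ι (proj₁ y))
  }

Realized : {L : Lang} → LGraph L → LGraph L → Set
Realized G A = Embedding A G

MinimallyOmitted : {L : Lang} → (G : LGraph L) → (A : LGraph L) → {n : ℕ} → Fin n ↔ V A → Set
MinimallyOmitted G A {n} e =
  ¬ Realized G A ×
  (∀ (S : Subset n) → (∃[ x ] x ∉ S) → Realized G (Induced A (Inverse.to e) S))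

-- If two vertices a, b in the same part of A are separated by a vertex z of
-- another part (col z a ≠ col z b), then A is realized: embed A − b and A − a
-- into G, use homogeneity to move the first copy of A − {a, b} onto the
-- second by an automorphism σ, and glue σ(copy of A − b) with the copy of
-- A − a. The two pieces agree on A − {a, b}, no edge joins a and b, and the
-- images of a and b differ because z sees them in different colours. So a
-- minimally omitted A has no separated pair, which forces every bipartite
-- restriction to be monochromatic.
module Submission where

open import Defs
open import Data.Nat as ℕ using (ℕ; suc)
open import Data.Fin using (Fin; zero; punchIn; punchOut; _≟_)
open import Data.Fin.Properties using (punchIn-injective; punchInᵢ≢i; punchIn-punchOut)
open import Data.Fin.Subset using (Subset; _∈_; ∁; ⁅_⁆)
open import Data.Fin.Subset.Properties using (x∉p⇒x∈∁p; x≢y⇒x∉⁅y⁆; x∈∁p⇒x∉p; x∉⁅y⁆⇒x≢y)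
open import Data.Vec.Properties.WithK using ([]=-irrelevant)
open import Data.Product using (Σ; ∃-syntax; _×_; _,_; proj₁)
open import Data.Sum using (_⊎_; inj₁; inj₂)
open import Data.Empty using (⊥-elim)
open import Function using (_∘_)
open import Function.Bundles using (_↔_; Inverse; Injection)
open import Function.Properties.Inverse using (↔⇒↣)
open import Relation.Nullary using (yes; no)
open import Relation.Binary.PropositionalEquality
  using (_≡_; _≢_; refl; sym; trans; cong; cong₂; subst₂; ≢-sym; module ≡-Reasoning)

private
  variable
    L : Lang
    n k : ℕ

subset-cong : {X : Set} {S : Subset n} (F : Σ (Fin n) (_∈ S) → X) →
              ∀ {i j} {p : i ∈ S} {q : j ∈ S} → i ≡ j → F (i , p) ≡ F (j , q)
subset-cong F {p = p} {q} refl = cong (λ r → F (_ , r)) ([]=-irrelevant p q)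

x≢y⇒x∈∁⁅y⁆ : {x y : Fin n} → x ≢ y → x ∈ ∁ ⁅ y ⁆
x≢y⇒x∈∁⁅y⁆ = x∉p⇒x∈∁p ∘ x≢y⇒x∉⁅y⁆

x∈∁⁅y⁆⇒x≢y : {x y : Fin n} → x ∈ ∁ ⁅ y ⁆ → x ≢ y
x∈∁⁅y⁆⇒x≢y = x∉⁅y⁆⇒x≢y ∘ x∈∁p⇒x∉p

module _ {a b : Fin (suc (suc k))} (a≢b : a ≢ b) where

  private
    a′ : Fin (suc k)
    a′ = punchOut (≢-sym a≢b)

    punchIn-b-a′ : punchIn b a′ ≡ a
    punchIn-b-a′ = punchIn-punchOut (≢-sym a≢b)

  punchIn₂ : Fin k → Fin (suc (suc k))
  punchIn₂ t = punchIn b (punchIn a′ t)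

  punchIn₂-injective : ∀ s t → punchIn₂ s ≡ punchIn₂ t → s ≡ t
  punchIn₂-injective s t = punchIn-injective a′ s t ∘ punchIn-injective b _ _

  punchIn₂≢ˡ : ∀ t → punchIn₂ t ≢ a
  punchIn₂≢ˡ t eq = punchInᵢ≢i a′ t (punchIn-injective b _ _ (trans eq (sym punchIn-b-a′)))

  punchIn₂≢ʳ : ∀ t → punchIn₂ t ≢ b
  punchIn₂≢ʳ t = punchInᵢ≢i b _

  punchIn₂-surjective : ∀ i → i ≢ a → i ≢ b → ∃[ t ] punchIn₂ t ≡ i
  punchIn₂-surjective i i≢a i≢b = punchOut a′≢j , trans (cong (punchIn b) (punchIn-punchOut a′≢j)) b-j≡i
    where
    j : Fin (suc k)
    j = punchOut (≢-sym i≢b)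

    b-j≡i : punchIn b j ≡ i
    b-j≡i = punchIn-punchOut (≢-sym i≢b)

    a′≢j : a′ ≢ j
    a′≢j a′≡j = i≢a (trans (sym b-j≡i) (trans (cong (punchIn b) (sym a′≡j)) punchIn-b-a′))

-- Homogeneity speaks about enumerated finite substructures, so embeddings are
-- also handled through an enumeration ι of (part of) A.
record TupleEmbedding (A : LGraph L) (ι : Fin n → V A) (G : LGraph L) : Set where
  field
    map       : Fin n → V G
    injective : ∀ s t → map s ≡ map t → s ≡ t
    part-pres : ∀ t → part G (map t) ≡ part A (ι t)
    col-pres  : ∀ s t → part A (ι s) ≢ part A (ι t) → col G (map s) (map t) ≡ col A (ι s) (ι t)

module _ {G A : LGraph L} where

  toEmbedding : (e : Fin n ↔ V A) → TupleEmbedding A (Inverse.to e) G → Embedding A G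
  toEmbedding e h = record
    { map       = map ∘ from
    ; injective = λ x y eq → trans (sym (to∘from x)) (trans (cong to (injective _ _ eq)) (to∘from y))
    ; part-pres = λ x → trans (part-pres (from x)) (cong (part A) (to∘from x))
    ; col-pres  = λ x y x≁y → trans
        (col-pres (from x) (from y)
          (subst₂ (λ u v → part A u ≢ part A v) (sym (to∘from x)) (sym (to∘from y)) x≁y))
        (cong₂ (col A) (to∘from x) (to∘from y))
    }
    where
    open Inverse e using (to; from) renaming (strictlyInverseˡ to to∘from)
    open TupleEmbedding h

  restrict : {ι : Fin n → V A} {S : Subset n} → Embedding (Induced A ι S) G →
             (g : Fin k → Fin n) → (∀ s t → g s ≡ g t → s ≡ t) → (∀ t → g t ∈ S) →
             TupleEmbedding A (ι ∘ g) G
  restrict f g g-injective g∈S = record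
    { map       = λ t → map (g t , g∈S t)
    ; injective = λ s t eq → g-injective s t (cong proj₁ (injective _ _ eq))
    ; part-pres = λ t → part-pres _
    ; col-pres  = λ s t → col-pres _ _
    }
    where open Embedding f

  _∘ᵉ_ : Automorphism G → Embedding A G → Embedding A G
  σ ∘ᵉ f = record
    { map       = to ∘ map
    ; injective = λ x y → injective x y ∘ Injection.injective (↔⇒↣ bij)
    ; part-pres = λ x → trans (Automorphism.part-pres σ (map x)) (part-pres x)
    ; col-pres  = λ x y x≁y → trans
        (Automorphism.col-pres σ (map x) (map y) λ eq →
          x≁y (trans (sym (part-pres x)) (trans eq (part-pres y))))
        (col-pres x y x≁y)
    }
    where
    open Embedding f
    open Automorphism σ using (bij)
    open Inverse bij using (to)

conjugate : {G A : LGraph L} {ι : Fin n → V A} → Homogeneous G →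
            (φ ψ : TupleEmbedding A ι G) →
            Σ (Automorphism G) λ σ → ∀ t →
              Inverse.to (Automorphism.bij σ) (TupleEmbedding.map φ t) ≡ TupleEmbedding.map ψ t
conjugate hom φ ψ = hom _ (map φ) (map ψ) (injective φ) (injective ψ)
  (λ t → trans (part-pres ψ t) (sym (part-pres φ t)))
  λ s t φs≁φt →
    let s≁t = λ eq → φs≁φt (trans (part-pres φ s) (trans eq (sym (part-pres φ t))))
    in trans (col-pres ψ s t s≁t) (sym (col-pres φ s t s≁t))
  where open TupleEmbedding

module _ {G A : LGraph L} {ι : Fin n → V A} {a b : Fin n} (a≢b : a ≢ b)
         (a∼b : part A (ι a) ≡ part A (ι b))
         (f : Embedding (Induced A ι (∁ ⁅ b ⁆)) G) (g : Embedding (Induced A ι (∁ ⁅ a ⁆)) G)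
         (agree : ∀ i p q → Embedding.map f (i , p) ≡ Embedding.map g (i , q)) where

  open Embedding

  private
    fa : V G
    fa = map f (a , x≢y⇒x∈∁⁅y⁆ a≢b)

    gb : V G
    gb = map g (b , x≢y⇒x∈∁⁅y⁆ (≢-sym a≢b))

    pair-cases : ∀ i j → (i ≢ b × j ≢ b) ⊎ (i ≢ a × j ≢ a) ⊎ (i ≡ a × j ≡ b) ⊎ (i ≡ b × j ≡ a)
    pair-cases i j with i ≟ b | j ≟ b
    ... | no i≢b | no j≢b = inj₁ (i≢b , j≢b)
    ... | yes refl | yes refl = inj₂ (inj₁ (≢-sym a≢b , ≢-sym a≢b))
    ... | yes refl | no j≢b with j ≟ a
    ...   | yes refl = inj₂ (inj₂ (inj₂ (refl , refl)))
    ...   | no j≢a = inj₂ (inj₁ (≢-sym a≢b , j≢a))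
    pair-cases i j | no i≢b | yes refl with i ≟ a
    ... | yes refl = inj₂ (inj₂ (inj₁ (refl , refl)))
    ... | no i≢a = inj₂ (inj₁ (i≢a , ≢-sym a≢b))

  glue : fa ≢ gb → TupleEmbedding A ι G
  glue fa≢gb = record { map = h ; injective = h-injective ; part-pres = h-part ; col-pres = h-col }
    where
    h : Fin n → V G
    h i with i ≟ a
    ... | yes _ = fa
    ... | no i≢a = map g (i , x≢y⇒x∈∁⁅y⁆ i≢a)

    h≡f : ∀ {i} (i≢b : i ≢ b) → h i ≡ map f (i , x≢y⇒x∈∁⁅y⁆ i≢b)
    h≡f {i} i≢b with i ≟ a
    ... | yes refl = subset-cong (map f) refl
    ... | no _ = sym (agree i _ _)

    h≡g : ∀ {i} (i≢a : i ≢ a) → h i ≡ map g (i , x≢y⇒x∈∁⁅y⁆ i≢a)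
    h≡g {i} i≢a with i ≟ a
    ... | yes i≡a = ⊥-elim (i≢a i≡a)
    ... | no _ = subset-cong (map g) refl

    h-part : ∀ i → part G (h i) ≡ part A (ι i)
    h-part i with i ≟ b
    ... | yes refl = trans (cong (part G) (h≡g (≢-sym a≢b))) (part-pres g _)
    ... | no i≢b = trans (cong (part G) (h≡f i≢b)) (part-pres f _)

    h-col : ∀ i j → part A (ι i) ≢ part A (ι j) → col G (h i) (h j) ≡ col A (ι i) (ι j)
    h-col i j i≁j with pair-cases i j
    ... | inj₁ (i≢b , j≢b) = trans (cong₂ (col G) (h≡f i≢b) (h≡f j≢b)) (col-pres f _ _ i≁j)
    ... | inj₂ (inj₁ (i≢a , j≢a)) = trans (cong₂ (col G) (h≡g i≢a) (h≡g j≢a)) (col-pres g _ _ i≁j)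
    ... | inj₂ (inj₂ (inj₁ (refl , refl))) = ⊥-elim (i≁j a∼b)
    ... | inj₂ (inj₂ (inj₂ (refl , refl))) = ⊥-elim (i≁j (sym a∼b))

    h-injective : ∀ i j → h i ≡ h j → i ≡ j
    h-injective i j hi≡hj with pair-cases i j
    ... | inj₁ (i≢b , j≢b) = cong proj₁ (injective f _ _ (trans (sym (h≡f i≢b)) (trans hi≡hj (h≡f j≢b))))
    ... | inj₂ (inj₁ (i≢a , j≢a)) = cong proj₁ (injective g _ _ (trans (sym (h≡g i≢a)) (trans hi≡hj (h≡g j≢a))))
    ... | inj₂ (inj₂ (inj₁ (refl , refl))) = ⊥-elim (fa≢gb (trans (sym (h≡f a≢b)) (trans hi≡hj (h≡g (≢-sym a≢b)))))
    ... | inj₂ (inj₂ (inj₂ (refl , refl))) = ⊥-elim (fa≢gb (trans (sym (h≡f a≢b)) (trans (sym hi≡hj) (h≡g (≢-sym a≢b)))))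

  separated : ∀ z → part A (ι z) ≢ part A (ι a) → col A (ι z) (ι a) ≢ col A (ι z) (ι b) → fa ≢ gb
  separated z z≁a za≢zb fa≡gb = za≢zb (begin
    col A (ι z) (ι a)                                   ≡⟨ col-pres f _ _ z≁a ⟨
    col G (map f (z , x≢y⇒x∈∁⁅y⁆ z≢b)) fa                ≡⟨ cong₂ (col G) (agree z _ _) fa≡gb ⟩
    col G (map g (z , x≢y⇒x∈∁⁅y⁆ z≢a)) gb                ≡⟨ col-pres g _ _ z≁b ⟩
    col A (ι z) (ι b)                                   ∎)
    where
    open ≡-Reasoning
    z≁b : part A (ι z) ≢ part A (ι b)
    z≁b eq = z≁a (trans eq (sym a∼b))
    z≢a : z ≢ a
    z≢a refl = z≁a refl
    z≢b : z ≢ b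
    z≢b refl = z≁b refl

amalgamate : {G A : LGraph L} {ι : Fin n → V A} → Homogeneous G → ∀ {a b z} → a ≢ b →
             part A (ι a) ≡ part A (ι b) → part A (ι z) ≢ part A (ι a) →
             col A (ι z) (ι a) ≢ col A (ι z) (ι b) →
             Embedding (Induced A ι (∁ ⁅ b ⁆)) G → Embedding (Induced A ι (∁ ⁅ a ⁆)) G →
             TupleEmbedding A ι G
amalgamate {n = suc (suc _)} {A = A} {ι} hom {z = z} a≢b a∼b z≁a za≢zb φ ψ =
  glue a≢b a∼b (σ ∘ᵉ φ) ψ agree (separated {A = A} {ι = ι} a≢b a∼b (σ ∘ᵉ φ) ψ agree z z≁a za≢zb)
  where
  open Σ (conjugate hom
    (restrict {A = A} {ι = ι} φ (punchIn₂ a≢b) (punchIn₂-injective a≢b) (x≢y⇒x∈∁⁅y⁆ ∘ punchIn₂≢ʳ a≢b))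
    (restrict {A = A} {ι = ι} ψ (punchIn₂ a≢b) (punchIn₂-injective a≢b) (x≢y⇒x∈∁⁅y⁆ ∘ punchIn₂≢ˡ a≢b)))
    renaming (proj₁ to σ; proj₂ to σφ≡ψ)

  agree : ∀ i p q → Embedding.map (σ ∘ᵉ φ) (i , p) ≡ Embedding.map ψ (i , q)
  agree i p q with punchIn₂-surjective a≢b i (x∈∁⁅y⁆⇒x≢y q) (x∈∁⁅y⁆⇒x≢y p)
  ... | t , refl = trans (cong (Inverse.to (Automorphism.bij σ)) (subset-cong (Embedding.map φ) refl))
                         (trans (σφ≡ψ t) (subset-cong (Embedding.map ψ) refl))
amalgamate {n = suc ℕ.zero} _ {zero} {zero} a≢b = ⊥-elim (a≢b refl)

module _ {G A : LGraph L} (hom : Homogeneous G) (e : Fin n ↔ V A) where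

  open Inverse e using (to; from) renaming (strictlyInverseˡ to to∘from)

  minimallyOmitted⇒twins : MinimallyOmitted G A e → ∀ {x y z} →
                           part A x ≡ part A y → part A z ≢ part A x → col A z x ≡ col A z y
  minimallyOmitted⇒twins (omitted , deletionRealized) {x} {y} {z} x∼y z≁x
    with from x | to∘from x | from y | to∘from y | from z | to∘from z
  ... | a | refl | b | refl | c | refl with col A (to c) (to a) ℕ.≟ col A (to c) (to b)
  ...   | yes ca≡cb = ca≡cb
  ...   | no ca≢cb = ⊥-elim (omitted (toEmbedding e
            (amalgamate {ι = to} hom {z = c} a≢b x∼y z≁x ca≢cb (deleted b) (deleted a))))
    where
    a≢b : a ≢ b
    a≢b refl = ca≢cb refl

    deleted : ∀ i → Embedding (Induced A to (∁ ⁅ i ⁆)) G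
    deleted i = deletionRealized (∁ ⁅ i ⁆) (i , λ i∈∁⁅i⁆ → x∈∁⁅y⁆⇒x≢y i∈∁⁅i⁆ refl)

lemma2p3 : (L : Lang) (G : LGraph L) → Homogeneous G → Generic G →
    (A : LGraph L) (n : ℕ) (e : Fin n ↔ V A) → MinimallyOmitted G A e →
    ∀ (x y x' y' : V A) → part A x ≢ part A y →
    part A x' ≡ part A x → part A y' ≡ part A y →
    col A x y ≡ col A x' y'
lemma2p3 L G hom _ A n e mo x y x' y' x≁y x'∼x y'∼y = begin
  col A x y    ≡⟨ minimallyOmitted⇒twins hom e mo (sym y'∼y) x≁y ⟩
  col A x y'   ≡⟨ col-sym A x y' x≁y' ⟩
  col A y' x   ≡⟨ minimallyOmitted⇒twins hom e mo (sym x'∼x) y'≁x ⟩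
  col A y' x'  ≡⟨ col-sym A y' x' y'≁x' ⟩
  col A x' y'  ∎
  where
  open ≡-Reasoning
  x≁y' : part A x ≢ part A y'
  x≁y' eq = x≁y (trans eq y'∼y)
  y'≁x : part A y' ≢ part A x
  y'≁x = ≢-sym x≁y'
  y'≁x' : part A y' ≢ part A x'
  y'≁x' eq = y'≁x (trans eq x'∼x)
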